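{- Let $\lambda=(c^r)$ with integers $c,r\ge 2$ (an irregular partition), let $n=cr$, and let $0\le k\le\binom{n}{2}$. If $k<\mathrm{dep}(\lambda)$ or $k=\mathrm{dep}(\lambda)+1$, then the coefficient of $q^k$ in the fake degree polynomial $f_\lambda(q)$ is $0$.
   Context: For a composition $\alpha=(\alpha_1,\dots,\alpha_l)$ (a finite sequence of positive integers; a partition is regarded as a composition), its depth is $\mathrm{dep}(\alpha)=\sum_{i=1}^{l}(i-1)\alpha_i$. For a standard Young tableau $T$ of shape $\lambda\vdash n$, $\mathrm{Des}\,T=\{i\in\{1,\dots,n-1\}: i+1 \text{ lies in a row strictly below the row of } i\}$ and $\mathrm{maj}(T)=\sum_{i\in\mathrm{Des}\,T}i$. The fake degree polynomial is $f_\lambda(q)=\sum_{T\in\mathrm{SYT}(\lambda)}q^{\mathrm{maj}(T)}$, where $\mathrm{SYT}(\lambda)$ is the set of standard Young tableaux of shape $\lambda$. -}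

module Defs where

open import Data.Nat using (ℕ; zero; suc; _+_; _*_; _∸_; _≤_; _<_; _<ᵇ_)
open import Data.Empty using (⊥)
open import Data.Bool using (if_then_else_)
open import Data.List using (List; []; _∷_)
open import Data.Nat.ListAction using (sum)
open import Data.Product using (Σ; _×_; ∃; ∃-syntax)
open import Relation.Binary.PropositionalEquality using (_≡_)

-- A partition / composition is a list of its parts (sh₁, sh₂, …).
-- Row lengths, with rows indexed from 0; rows beyond the last have length 0.
rowLen : List ℕ → ℕ → ℕ
rowLen []       _       = 0
rowLen (a ∷ as) zero    = a
rowLen (a ∷ as) (suc i) = rowLen as i

-- depth: dep(α) = Σ_i (i-1) α_i  (1-indexed), computed with a running index.
depFrom : ℕ → List ℕ → ℕ
depFrom _ []       = 0
depFrom i (a ∷ as) = i * a + depFrom (suc i) as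

dep : List ℕ → ℕ
dep = depFrom 0

InShape : List ℕ → ℕ → ℕ → Set
InShape sh i j = j < rowLen sh i

-- The field `row` records the row containing each entry; it is uniquely
-- determined by `entry` (via `row-ok` and bijectivity), so it adds no data.
record SYT (sh : List ℕ) : Set where
  field
    entry    : ℕ → ℕ → ℕ
    row      : ℕ → ℕ
    inRange  : ∀ i j → InShape sh i j → 1 ≤ entry i j × entry i j ≤ sum sh
    injective : ∀ i j i' j' → InShape sh i j → InShape sh i' j' →
                entry i j ≡ entry i' j' → (i ≡ i') × (j ≡ j')
    surjective : ∀ m → 1 ≤ m → m ≤ sum sh →
                 ∃[ i ] ∃[ j ] (InShape sh i j × entry i j ≡ m)
    rowIncr  : ∀ i j → InShape sh i (suc j) → entry i j < entry i (suc j)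
    colIncr  : ∀ i j → InShape sh (suc i) j → entry i j < entry (suc i) j
    row-ok   : ∀ i j → InShape sh i j → row (entry i j) ≡ i

open SYT public

-- Σ_{m=1}^{N} (m if m ∈ Des T else 0), where m ∈ Des T iff the row of m+1
-- is strictly below (has larger index than) the row of m.
majUpTo : (ℕ → ℕ) → ℕ → ℕ
majUpTo rw zero    = 0
majUpTo rw (suc m) = majUpTo rw m + (if rw (suc m) <ᵇ rw (suc (suc m)) then suc m else 0)

maj : {sh : List ℕ} → SYT sh → ℕ
maj {sh} T = majUpTo (row T) (sum sh ∸ 1)

-- The coefficient of q^k in f_λ(q) = Σ_T q^{maj T} is #{T ∈ SYT(sh) : maj T = k};
-- it is 0 exactly when no such T exists.
FakeDegreeCoeffZero : List ℕ → ℕ → Set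
FakeDegreeCoeffZero sh k = ∀ (T : SYT sh) → maj T ≡ k → ⊥

-- A descent d of T contributes d = #{m : 1 ≤ m ≤ d} to maj T, so
-- maj T = Σ_{m=1}^{n} D(m), where D(m) counts the descents d ≥ m. Following a
-- column downwards from an entry v in row i gives r-1-i descents ≥ v, and the
-- entries m, …, n cannot all fit below row ⌊(m-1)/c⌋; hence
-- D(m) ≥ r-1-⌊(m-1)/c⌋, and these bounds sum to dep(c^r), so maj T ≥ dep(c^r).
-- Dually, row(v) is at most the number of descents d < v, which forces
-- D(m) ≤ D(1) - ⌊(m-1)/c⌋. If maj T = dep(c^r)+1, all bounds for m ≥ 2 are
-- tight and D(1) = r; then 1 is a descent and every v > c leaves row 0, so the
-- n-c+1 entries 2, c+1, …, n all lie in the n-c cells of rows 1, …, r-1.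
module Submission where

open import Defs
open import Data.Nat
open import Data.Nat.Properties
open import Data.Nat.DivMod
open import Data.Nat.ListAction using (sum)
open import Data.Nat.Combinatorics using (_C_)
open import Data.Bool using (true; false; if_then_else_; T)
open import Data.List using (replicate)
open import Data.Fin using (Fin; toℕ; fromℕ<; combine) renaming (zero to fzero; suc to fsuc)
open import Data.Fin.Properties
  using (injective⇒≤; combine-injective; toℕ-fromℕ<; toℕ-injective; toℕ<n; ¬∀⟶∃¬)
open import Data.Product using (_×_; _,_; proj₁; proj₂; ∃-syntax)
open import Data.Sum using (_⊎_; inj₁; inj₂; [_,_]′)
open import Data.Empty using (⊥; ⊥-elim)
open import Relation.Nullary using (¬_; yes; no)
open import Relation.Binary.PropositionalEquality
open import Data.Nat.Solver using (module +-*-Solver)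
open +-*-Solver using (solve; _:=_; _:+_; _:*_; con)

∑ : (ℕ → ℕ) → ℕ → ℕ
∑ f zero    = 0
∑ f (suc N) = ∑ f N + f (suc N)

∑-cong : ∀ f g N → (∀ m → 1 ≤ m → m ≤ N → f m ≡ g m) → ∑ f N ≡ ∑ g N
∑-cong f g zero    f≡g = refl
∑-cong f g (suc N) f≡g =
  cong₂ _+_ (∑-cong f g N (λ m p q → f≡g m p (m≤n⇒m≤1+n q))) (f≡g (suc N) z<s ≤-refl)

∑-mono-≤ : ∀ f g N → (∀ m → 1 ≤ m → m ≤ N → f m ≤ g m) → ∑ f N ≤ ∑ g N
∑-mono-≤ f g zero    f≤g = z≤n
∑-mono-≤ f g (suc N) f≤g =
  +-mono-≤ (∑-mono-≤ f g N (λ m p q → f≤g m p (m≤n⇒m≤1+n q))) (f≤g (suc N) z<s ≤-refl)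

∑-distrib-+ : ∀ f g N → ∑ (λ m → f m + g m) N ≡ ∑ f N + ∑ g N
∑-distrib-+ f g zero = refl
∑-distrib-+ f g (suc N) rewrite ∑-distrib-+ f g N =
  solve 4 (λ a b x y → (a :+ b) :+ (x :+ y) := (a :+ x) :+ (b :+ y)) refl
    (∑ f N) (∑ g N) (f (suc N)) (g (suc N))

∑-const : ∀ a N → ∑ (λ _ → a) N ≡ N * a
∑-const a zero = refl
∑-const a (suc N) rewrite ∑-const a N = +-comm (N * a) a

∑-suc : ∀ f N → ∑ f (suc N) ≡ f 1 + ∑ (λ m → f (suc m)) N
∑-suc f zero = +-comm 0 (f 1)
∑-suc f (suc N) rewrite ∑-suc f N = +-assoc (f 1) _ _

∑-+ : ∀ f a M → ∑ f (a + M) ≡ ∑ f a + ∑ (λ m → f (a + m)) M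
∑-+ f a zero rewrite +-identityʳ a = sym (+-identityʳ _)
∑-+ f a (suc M) rewrite +-suc a M | ∑-+ f a M = +-assoc (∑ f a) _ _

∑-≤-pointwise : ∀ f g N → (∀ m → 1 ≤ m → m ≤ N → g m ≤ f m) → ∑ f N ≤ ∑ g N →
  ∀ m → 1 ≤ m → m ≤ N → f m ≤ g m
∑-≤-pointwise f g zero g≤f Σ≤ m p q = ⊥-elim (<⇒≱ p q)
∑-≤-pointwise f g (suc N) g≤f Σ≤ m p q with m≤n⇒m<n∨m≡n q
... | inj₁ m<1+N = ∑-≤-pointwise f g N g≤f′ Σ≤′ m p (s≤s⁻¹ m<1+N)
  where
    g≤f′ : ∀ m → 1 ≤ m → m ≤ N → g m ≤ f m
    g≤f′ m p q = g≤f m p (m≤n⇒m≤1+n q)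
    Σ≤′ : ∑ f N ≤ ∑ g N
    Σ≤′ = +-cancelʳ-≤ (f (suc N)) _ _
            (≤-trans Σ≤ (+-monoʳ-≤ (∑ g N) (g≤f (suc N) z<s ≤-refl)))
... | inj₂ refl = +-cancelˡ-≤ (∑ g N) _ _
      (≤-trans (+-monoˡ-≤ (f (suc N)) (∑-mono-≤ g f N (λ m p q → g≤f m p (m≤n⇒m≤1+n q)))) Σ≤)

descentAt : (ℕ → ℕ) → ℕ → ℕ
descentAt rw d = if rw d <ᵇ rw (suc d) then 1 else 0

descentAt-rise : ∀ rw d → 1 ≤ descentAt rw d → rw d < rw (suc d)
descentAt-rise rw d 1≤ with rw d <ᵇ rw (suc d) in eq
... | true  = <ᵇ⇒< (rw d) (rw (suc d)) (subst T (sym eq) _)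
... | false = ⊥-elim (<-irrefl refl 1≤)

descents : (ℕ → ℕ) → ℕ → ℕ → ℕ
descents rw a zero    = 0
descents rw a (suc l) = descentAt rw a + descents rw (suc a) l

descents-+ : ∀ rw a l₁ l₂ → descents rw a (l₁ + l₂) ≡ descents rw a l₁ + descents rw (a + l₁) l₂
descents-+ rw a zero l₂ rewrite +-identityʳ a = refl
descents-+ rw a (suc l₁) l₂ rewrite descents-+ rw (suc a) l₁ l₂ | +-suc a l₁ =
  sym (+-assoc (descentAt rw a) _ _)

descents-suc : ∀ rw a l → descents rw a (suc l) ≡ descents rw a l + descentAt rw (a + l)
descents-suc rw a l = begin
  descents rw a (suc l)                      ≡⟨ cong (descents rw a) (+-comm 1 l) ⟩
  descents rw a (l + 1)                      ≡⟨ descents-+ rw a l 1 ⟩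
  descents rw a l + (descentAt rw (a + l) + 0) ≡⟨ cong (descents rw a l +_) (+-identityʳ _) ⟩
  descents rw a l + descentAt rw (a + l)     ∎
  where open ≡-Reasoning

descents-split : ∀ rw u v w → u ≤ v → v ≤ w →
  descents rw u (w ∸ u) ≡ descents rw u (v ∸ u) + descents rw v (w ∸ v)
descents-split rw u v w u≤v v≤w = begin
  descents rw u (w ∸ u)                                ≡⟨ cong (descents rw u) (sym lengths) ⟩
  descents rw u ((v ∸ u) + (w ∸ v))                    ≡⟨ descents-+ rw u (v ∸ u) (w ∸ v) ⟩
  descents rw u (v ∸ u) + descents rw (u + (v ∸ u)) (w ∸ v)
    ≡⟨ cong (λ z → descents rw u (v ∸ u) + descents rw z (w ∸ v)) (m+[n∸m]≡n u≤v) ⟩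
  descents rw u (v ∸ u) + descents rw v (w ∸ v)        ∎
  where
    open ≡-Reasoning
    lengths : (v ∸ u) + (w ∸ v) ≡ w ∸ u
    lengths = begin
      (v ∸ u) + (w ∸ v) ≡⟨ +-comm (v ∸ u) (w ∸ v) ⟩
      (w ∸ v) + (v ∸ u) ≡⟨ sym (+-∸-assoc (w ∸ v) u≤v) ⟩
      (w ∸ v) + v ∸ u   ≡⟨ cong (_∸ u) (m∸n+n≡m v≤w) ⟩
      w ∸ u             ∎

descents-pos : ∀ rw l a → rw a < rw (a + l) → 1 ≤ descents rw a l
descents-pos rw zero a lt rewrite +-identityʳ a = ⊥-elim (<-irrefl refl lt)
descents-pos rw (suc l) a lt with rw a <ᵇ rw (suc a) in eq
... | true  = s≤s z≤n
... | false = ≤-trans (descents-pos rw l (suc a) lt′) (m≤n+m _ 0)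
  where
    no-rise : rw (suc a) ≤ rw a
    no-rise = ≮⇒≥ (λ x → subst T eq (<⇒<ᵇ x))
    lt′ : rw (suc a) < rw (suc a + l)
    lt′ = ≤-<-trans no-rise (subst (λ z → rw a < rw z) (+-suc a l) lt)

descents-split-rise : ∀ rw u v w → u ≤ v → v ≤ w → rw u < rw v →
  suc (descents rw v (w ∸ v)) ≤ descents rw u (w ∸ u)
descents-split-rise rw u v w u≤v v≤w lt rewrite descents-split rw u v w u≤v v≤w =
  +-monoˡ-≤ (descents rw v (w ∸ v))
    (descents-pos rw (v ∸ u) u (subst (λ z → rw u < rw z) (sym (m+[n∸m]≡n u≤v)) lt))

descent-term : ∀ rw m → (if rw m <ᵇ rw (suc m) then m else 0) ≡ descentAt rw m * m
descent-term rw m with rw m <ᵇ rw (suc m)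
... | true  = sym (+-identityʳ m)
... | false = refl

-- Exchanging the order of summation: the descent d is counted once for each m ≤ d.
majUpTo≡∑descents : ∀ rw N → majUpTo rw N ≡ ∑ (λ m → descents rw m (suc N ∸ m)) N
majUpTo≡∑descents rw zero = refl
majUpTo≡∑descents rw (suc N) = begin
  majUpTo rw N + (if rw (suc N) <ᵇ rw (suc (suc N)) then suc N else 0)
    ≡⟨ cong₂ _+_ (majUpTo≡∑descents rw N) (descent-term rw (suc N)) ⟩
  S + i * suc N
    ≡⟨ solve 3 (λ S N i → S :+ i :* (con 1 :+ N) := (S :+ N :* i) :+ (i :+ con 0)) refl S N i ⟩
  (S + N * i) + (i + 0)
    ≡⟨ cong₂ _+_ (sym extend) (sym (cong (descents rw (suc N)) (m+n∸n≡m 1 N))) ⟩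
  ∑ (λ m → descents rw m (suc (suc N) ∸ m)) N + descents rw (suc N) (suc (suc N) ∸ suc N) ∎
  where
    open ≡-Reasoning
    S = ∑ (λ m → descents rw m (suc N ∸ m)) N
    i = descentAt rw (suc N)
    extend₁ : ∀ m → 1 ≤ m → m ≤ N →
      descents rw m (suc (suc N) ∸ m) ≡ descents rw m (suc N ∸ m) + i
    extend₁ m _ m≤N = begin
      descents rw m (suc (suc N) ∸ m)   ≡⟨ cong (descents rw m) (+-∸-assoc 1 (m≤n⇒m≤1+n m≤N)) ⟩
      descents rw m (suc (suc N ∸ m))   ≡⟨ descents-suc rw m (suc N ∸ m) ⟩
      descents rw m (suc N ∸ m) + descentAt rw (m + (suc N ∸ m))
        ≡⟨ cong (λ z → descents rw m (suc N ∸ m) + descentAt rw z) (m+[n∸m]≡n (m≤n⇒m≤1+n m≤N)) ⟩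
      descents rw m (suc N ∸ m) + i     ∎
    extend : ∑ (λ m → descents rw m (suc (suc N) ∸ m)) N ≡ S + N * i
    extend = begin
      ∑ (λ m → descents rw m (suc (suc N) ∸ m)) N ≡⟨ ∑-cong _ _ N extend₁ ⟩
      ∑ (λ m → descents rw m (suc N ∸ m) + i) N
        ≡⟨ ∑-distrib-+ (λ m → descents rw m (suc N ∸ m)) (λ _ → i) N ⟩
      S + ∑ (λ _ → i) N                           ≡⟨ cong (S +_) (∑-const i N) ⟩
      S + N * i                                   ∎

depFrom-suc : ∀ c i r → depFrom (suc i) (replicate r c) ≡ r * c + depFrom i (replicate r c)
depFrom-suc c i zero = refl
depFrom-suc c i (suc r) rewrite depFrom-suc c (suc i) r =
  solve 4 (λ c a b d → (c :+ a) :+ (b :+ d) := (c :+ b) :+ (a :+ d)) refl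
    c (i * c) (r * c) (depFrom (suc i) (replicate r c))

-- Lower bound for the number of descents ≥ m in a tableau of shape (c^r).
descentBound : (c r : ℕ) .{{_ : NonZero c}} → ℕ → ℕ
descentBound c r m = (r ∸ 1) ∸ (m ∸ 1) / c

∑descentBound≡dep : ∀ c r .{{_ : NonZero c}} → ∑ (descentBound c r) (r * c) ≡ dep (replicate r c)
∑descentBound≡dep c zero = refl
∑descentBound≡dep c (suc r) = begin
  ∑ (descentBound c (suc r)) (c + r * c)
    ≡⟨ ∑-+ _ c (r * c) ⟩
  ∑ (descentBound c (suc r)) c + ∑ (λ m → descentBound c (suc r) (c + m)) (r * c)
    ≡⟨ cong₂ _+_ (trans (∑-cong _ _ c firstBlock) (∑-const r c)) (∑-cong _ _ (r * c) laterBlocks) ⟩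
  c * r + ∑ (descentBound c r) (r * c)
    ≡⟨ cong₂ _+_ (*-comm c r) (∑descentBound≡dep c r) ⟩
  r * c + dep (replicate r c)
    ≡⟨ sym (depFrom-suc c 0 r) ⟩
  dep (replicate (suc r) c) ∎
  where
    open ≡-Reasoning
    firstBlock : ∀ m → 1 ≤ m → m ≤ c → descentBound c (suc r) m ≡ r
    firstBlock (suc m) _ m<c rewrite m<n⇒m/n≡0 m<c = refl
    laterBlocks : ∀ m → 1 ≤ m → m ≤ r * c → descentBound c (suc r) (c + m) ≡ descentBound c r m
    laterBlocks (suc m) _ _ = begin
      r ∸ (c + suc m ∸ 1) / c  ≡⟨ cong (λ z → r ∸ (z ∸ 1) / c) (+-suc c m) ⟩
      r ∸ (c + m) / c          ≡⟨ cong (r ∸_) (m/n≡1+[m∸n]/n (m≤m+n c m)) ⟩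
      r ∸ suc ((c + m ∸ c) / c) ≡⟨ cong (λ z → r ∸ suc (z / c)) (m+n∸m≡n c m) ⟩
      r ∸ suc (m / c)          ≡⟨ sym (∸-+-assoc r 1 (m / c)) ⟩
      r ∸ 1 ∸ m / c            ∎

rowLen-replicate-< : ∀ r c i → i < r → rowLen (replicate r c) i ≡ c
rowLen-replicate-< (suc r) c zero    _       = refl
rowLen-replicate-< (suc r) c (suc i) (s≤s p) = rowLen-replicate-< r c i p

rowLen-replicate-≥ : ∀ r c i → r ≤ i → rowLen (replicate r c) i ≡ 0
rowLen-replicate-≥ zero    c i       _       = refl
rowLen-replicate-≥ (suc r) c (suc i) (s≤s p) = rowLen-replicate-≥ r c i p

InShape-replicate⁻ : ∀ r c i j → InShape (replicate r c) i j → i < r × j < c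
InShape-replicate⁻ r c i j ins with i <? r
... | yes i<r = i<r , subst (j <_) (rowLen-replicate-< r c i i<r) ins
... | no i≮r  = ⊥-elim (<⇒≱ (subst (j <_) (rowLen-replicate-≥ r c i (≮⇒≥ i≮r)) ins) z≤n)

InShape-replicate⁺ : ∀ r c i j → i < r → j < c → InShape (replicate r c) i j
InShape-replicate⁺ r c i j i<r j<c = subst (j <_) (sym (rowLen-replicate-< r c i i<r)) j<c

sum-replicate : ∀ r c → sum (replicate r c) ≡ r * c
sum-replicate zero    c = refl
sum-replicate (suc r) c = cong (c +_) (sum-replicate r c)

module RectangularTableau (c₁ r₁ : ℕ) (T : SYT (replicate (suc r₁) (suc c₁))) where
  c r n : ℕ
  c = suc c₁
  r = suc r₁
  n = r * c

  rw : ℕ → ℕ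
  rw = row T

  E : ℕ → ℕ → ℕ
  E = entry T

  descentsAfter : ℕ → ℕ
  descentsAfter m = descents rw m (n ∸ m)

  descentsBefore : ℕ → ℕ
  descentsBefore m = descents rw 1 (m ∸ 1)

  bound : ℕ → ℕ
  bound = descentBound c r

  record Cell (v : ℕ) : Set where
    field
      i      : ℕ
      j      : ℕ
      i<r    : i < r
      j<c    : j < c
      entry≡ : E i j ≡ v
      row≡   : rw v ≡ i

  locate : ∀ v → 1 ≤ v → v ≤ n → Cell v
  locate v 1≤v v≤n with surjective T v 1≤v (subst (v ≤_) (sym (sum-replicate r c)) v≤n)
  ... | i , j , ins , e = record
    { i = i ; j = j
    ; i<r = proj₁ (InShape-replicate⁻ r c i j ins)
    ; j<c = proj₂ (InShape-replicate⁻ r c i j ins)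
    ; entry≡ = e
    ; row≡ = trans (cong rw (sym e)) (row-ok T i j ins) }

  row<r : ∀ v → 1 ≤ v → v ≤ n → rw v < r
  row<r v 1≤v v≤n = subst (_< r) (sym row≡) i<r
    where open Cell (locate v 1≤v v≤n)

  module _ (i j : ℕ) (i<r : i < r) (j<c : j < c) where
    private ins = InShape-replicate⁺ r c i j i<r j<c

    entry≥1 : 1 ≤ E i j
    entry≥1 = proj₁ (inRange T i j ins)

    entry≤n : E i j ≤ n
    entry≤n = subst (E i j ≤_) (sum-replicate r c) (proj₂ (inRange T i j ins))

    row-entry : rw (E i j) ≡ i
    row-entry = row-ok T i j ins

  module _ (i j : ℕ) (1+i<r : suc i < r) (j<c : j < c) where
    private i<r = <-trans (n<1+n i) 1+i<r

    entry-down : E i j < E (suc i) j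
    entry-down = colIncr T i j (InShape-replicate⁺ r c (suc i) j 1+i<r j<c)

    row-rise-down : rw (E i j) < rw (E (suc i) j)
    row-rise-down = subst₂ _<_ (sym (row-entry i j i<r j<c)) (sym (row-entry (suc i) j 1+i<r j<c))
                      (n<1+n i)

  -- Each step down the column that ends at E i j crosses a descent d < E i j.
  row-entry-≤-descentsBefore : ∀ i j → i < r → j < c → i ≤ descentsBefore (E i j)
  row-entry-≤-descentsBefore zero    j _     _   = z≤n
  row-entry-≤-descentsBefore (suc i) j 1+i<r j<c = begin
    suc i                                    ≡⟨ +-comm 1 i ⟩
    i + 1                                    ≤⟨ +-mono-≤ (row-entry-≤-descentsBefore i j i<r j<c) rise ⟩
    descentsBefore u + descents rw u (v ∸ u) ≡⟨ sym (descents-split rw 1 u v (entry≥1 i j i<r j<c) (<⇒≤ u<v)) ⟩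
    descentsBefore v                         ∎
    where
      open ≤-Reasoning
      i<r = <-trans (n<1+n i) 1+i<r
      u = E i j
      v = E (suc i) j
      u<v = entry-down i j 1+i<r j<c
      rise : 1 ≤ descents rw u (v ∸ u)
      rise = descents-pos rw (v ∸ u) u
               (subst (λ z → rw u < rw z) (sym (m+[n∸m]≡n (<⇒≤ u<v))) (row-rise-down i j 1+i<r j<c))

  row-≤-descentsBefore : ∀ v → 1 ≤ v → v ≤ n → rw v ≤ descentsBefore v
  row-≤-descentsBefore v 1≤v v≤n =
    subst₂ (λ a b → a ≤ descentsBefore b) (sym row≡) entry≡ (row-entry-≤-descentsBefore i j i<r j<c)
    where open Cell (locate v 1≤v v≤n)

  rowsBelow-entry-≤-descentsAfter : ∀ d i j → i + d < r → j < c → d ≤ descentsAfter (E i j)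
  rowsBelow-entry-≤-descentsAfter zero    i j _ _ = z≤n
  rowsBelow-entry-≤-descentsAfter (suc d) i j i+d<r j<c =
    ≤-trans (s≤s (rowsBelow-entry-≤-descentsAfter d (suc i) j i+d<r′ j<c))
      (descents-split-rise rw (E i j) (E (suc i) j) n (<⇒≤ (entry-down i j 1+i<r j<c))
        (entry≤n (suc i) j 1+i<r j<c) (row-rise-down i j 1+i<r j<c))
    where
      i+d<r′ : suc i + d < r
      i+d<r′ = subst (_< r) (+-suc i d) i+d<r
      1+i<r : suc i < r
      1+i<r = ≤-<-trans (s≤s (m≤m+n i d)) i+d<r′

  rowsBelow-≤-descentsAfter : ∀ v → 1 ≤ v → v ≤ n → r₁ ∸ rw v ≤ descentsAfter v
  rowsBelow-≤-descentsAfter v 1≤v v≤n =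
    subst₂ (λ a b → r₁ ∸ a ≤ descentsAfter b) (sym row≡) entry≡
      (rowsBelow-entry-≤-descentsAfter (r₁ ∸ i) i j
        (subst (_< r) (sym (m+[n∸m]≡n (s≤s⁻¹ i<r))) (n<1+n r₁)) j<c)
    where open Cell (locate v 1≤v v≤n)

  -- Rows lo, …, lo+h-1 have h·c cells; an entry is sent to its (row - lo, column).
  band-capacity : ∀ K (f : Fin K → ℕ) lo h → (∀ x → 1 ≤ f x) → (∀ x → f x ≤ n) →
    (∀ x → lo ≤ rw (f x)) → (∀ x → rw (f x) < lo + h) →
    (∀ x y → f x ≡ f y → x ≡ y) → K ≤ h * c
  band-capacity K f lo h f≥1 f≤n lo≤ <hi f-inj = injective⇒≤ {f = cellOf} cellOf-inj
    where
      cell : ∀ x → Cell (f x)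
      cell x = locate (f x) (f≥1 x) (f≤n x)
      lo≤i : ∀ x → lo ≤ Cell.i (cell x)
      lo≤i x = subst (lo ≤_) (Cell.row≡ (cell x)) (lo≤ x)
      offset< : ∀ x → Cell.i (cell x) ∸ lo < h
      offset< x = +-cancelˡ-< lo _ _
        (subst (_< lo + h) (sym (m+[n∸m]≡n (lo≤i x))) (subst (_< lo + h) (Cell.row≡ (cell x)) (<hi x)))
      cellOf : Fin K → Fin (h * c)
      cellOf x = combine (fromℕ< (offset< x)) (fromℕ< (Cell.j<c (cell x)))
      cellOf-inj : ∀ {x y} → cellOf x ≡ cellOf y → x ≡ y
      cellOf-inj {x} {y} eq =
        f-inj x y (trans (sym (Cell.entry≡ (cell x))) (trans (cong₂ E i≡ j≡) (Cell.entry≡ (cell y))))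
        where
          parts = combine-injective (fromℕ< (offset< x)) (fromℕ< (Cell.j<c (cell x)))
                    (fromℕ< (offset< y)) (fromℕ< (Cell.j<c (cell y))) eq
          offset≡ : Cell.i (cell x) ∸ lo ≡ Cell.i (cell y) ∸ lo
          offset≡ = trans (sym (toℕ-fromℕ< (offset< x)))
                      (trans (cong toℕ (proj₁ parts)) (toℕ-fromℕ< (offset< y)))
          i≡ : Cell.i (cell x) ≡ Cell.i (cell y)
          i≡ = trans (sym (m+[n∸m]≡n (lo≤i x))) (trans (cong (lo +_) offset≡) (m+[n∸m]≡n (lo≤i y)))
          j≡ : Cell.j (cell x) ≡ Cell.j (cell y)
          j≡ = trans (sym (toℕ-fromℕ< (Cell.j<c (cell x))))
                 (trans (cong toℕ (proj₂ parts)) (toℕ-fromℕ< (Cell.j<c (cell y))))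

  interval-capacity : ∀ a K lo h → 1 ≤ a → a + K ≤ suc n →
    (∀ (x : Fin K) → lo ≤ rw (a + toℕ x)) → (∀ x → rw (a + toℕ x) < lo + h) → K ≤ h * c
  interval-capacity a K lo h 1≤a a+K≤1+n lo≤ <hi =
    band-capacity K (λ x → a + toℕ x) lo h
      (λ _ → ≤-trans 1≤a (m≤m+n a _))
      (λ x → s≤s⁻¹ (≤-trans (+-monoʳ-< a (toℕ<n x)) a+K≤1+n))
      lo≤ <hi
      (λ x y e → toℕ-injective (+-cancelˡ-≡ a _ _ e))

  descentsAfter-antitone : ∀ m v → m ≤ v → v ≤ n → descentsAfter v ≤ descentsAfter m
  descentsAfter-antitone m v m≤v v≤n rewrite descents-split rw m v n m≤v v≤n = m≤n+m _ _

  tail-entry≤n : ∀ q → q ≤ n → (x : Fin (n ∸ q)) → suc q + toℕ x ≤ n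
  tail-entry≤n q q≤n x =
    s≤s⁻¹ (subst (suc q + toℕ x <_) (cong suc (m+[n∸m]≡n q≤n)) (+-monoʳ-< (suc q) (toℕ<n x)))

  -- The n-q entries q+1, …, n do not fit into the rows strictly below ⌊q/c⌋.
  entry-in-rows-≤-after : ∀ q → suc q ≤ n → ∃[ v ] (suc q ≤ v × v ≤ n × rw v ≤ q / c)
  entry-in-rows-≤-after q 1+q≤n =
    witness (¬∀⟶∃¬ (n ∸ q) (λ x → p < rw (v x)) (λ x → p <? rw (v x)) not-all-below)
    where
      p = q / c
      v : Fin (n ∸ q) → ℕ
      v x = suc q + toℕ x
      p<r : p < r
      p<r = m<n*o⇒m/o<n {q} {r} {c} 1+q≤n
      too-many : (r ∸ suc p) * c < n ∸ q
      too-many = subst (_< n ∸ q) (sym (*-distribʳ-∸ c r (suc p)))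
        (∸-monoʳ-< (subst (_< suc p * c) (sym (m≡m%n+[m/n]*n q c)) (+-monoˡ-< (p * c) (m%n<n q c)))
                   (*-monoˡ-≤ c p<r))
      not-all-below : ¬ (∀ x → p < rw (v x))
      not-all-below below = <⇒≱ too-many
        (interval-capacity (suc q) (n ∸ q) (suc p) (r ∸ suc p) z<s
          (≤-reflexive (cong suc (m+[n∸m]≡n (<⇒≤ 1+q≤n))))
          below
          (λ x → subst (rw (v x) <_) (sym (m+[n∸m]≡n p<r))
                   (row<r (v x) z<s (tail-entry≤n q (<⇒≤ 1+q≤n) x))))
      witness : ∃[ x ] ¬ p < rw (v x) → ∃[ v ] (suc q ≤ v × v ≤ n × rw v ≤ p)
      witness (x , rw≮p) = v x , m≤m+n (suc q) _ , tail-entry≤n q (<⇒≤ 1+q≤n) x , ≮⇒≥ rw≮p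

  bound-≤-descentsAfter : ∀ m → 1 ≤ m → m ≤ n → bound m ≤ descentsAfter m
  bound-≤-descentsAfter (suc q) _ 1+q≤n = through (entry-in-rows-≤-after q 1+q≤n)
    where
      through : ∃[ v ] (suc q ≤ v × v ≤ n × rw v ≤ q / c) → r₁ ∸ q / c ≤ descentsAfter (suc q)
      through (v , 1+q≤v , v≤n , rw≤) = begin
        r₁ ∸ q / c            ≤⟨ ∸-monoʳ-≤ r₁ rw≤ ⟩
        r₁ ∸ rw v             ≤⟨ rowsBelow-≤-descentsAfter v (≤-trans z<s 1+q≤v) v≤n ⟩
        descentsAfter v       ≤⟨ descentsAfter-antitone (suc q) v 1+q≤v v≤n ⟩
        descentsAfter (suc q) ∎
        where open ≤-Reasoning

  descentsBefore-monotone : ∀ v m → 1 ≤ v → v ≤ m → descentsBefore v ≤ descentsBefore m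
  descentsBefore-monotone v m 1≤v v≤m rewrite descents-split rw 1 v m 1≤v v≤m = m≤m+n _ _

  descentsBefore+descentsAfter : ∀ m → 1 ≤ m → m ≤ n →
    descentsAfter 1 ≡ descentsBefore m + descentsAfter m
  descentsBefore+descentsAfter m 1≤m m≤n = descents-split rw 1 m n 1≤m m≤n

  -- The entries 1, …, m all lie in the rows 0, …, descentsBefore m.
  quotient-≤-descentsBefore : ∀ m → 1 ≤ m → m ≤ n → (m ∸ 1) / c ≤ descentsBefore m
  quotient-≤-descentsBefore (suc q) _ 1+q≤n = s≤s⁻¹ (m<n*o⇒m/o<n {q} {suc H} {c} fits)
    where
      H = descentsBefore (suc q)
      row≤H : ∀ (x : Fin (suc q)) → rw (suc (toℕ x)) < 0 + suc H
      row≤H x = s≤s (≤-trans (row-≤-descentsBefore (suc (toℕ x)) z<s (≤-trans (toℕ<n x) 1+q≤n))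
                             (descentsBefore-monotone (suc (toℕ x)) (suc q) z<s (toℕ<n x)))
      fits : suc q ≤ suc H * c
      fits = interval-capacity 1 (suc q) 0 (suc H) ≤-refl (s≤s 1+q≤n) (λ _ → z≤n) row≤H

  descentsAfter-≤-bound : descentsAfter 1 ≤ r₁ → ∀ m → 1 ≤ m → m ≤ n → descentsAfter m ≤ bound m
  descentsAfter-≤-bound D₁≤r₁ m 1≤m m≤n = begin
    descentsAfter m                   ≡⟨ sym (m+n∸m≡n (descentsBefore m) (descentsAfter m)) ⟩
    descentsBefore m + descentsAfter m ∸ descentsBefore m
      ≡⟨ cong (_∸ descentsBefore m) (sym (descentsBefore+descentsAfter m 1≤m m≤n)) ⟩
    descentsAfter 1 ∸ descentsBefore m ≤⟨ ∸-mono D₁≤r₁ (quotient-≤-descentsBefore m 1≤m m≤n) ⟩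
    r₁ ∸ (m ∸ 1) / c                  ∎
    where open ≤-Reasoning

  maj≡∑descentsAfter : maj T ≡ ∑ descentsAfter n
  maj≡∑descentsAfter = begin
    majUpTo rw (sum (replicate r c) ∸ 1) ≡⟨ cong (λ z → majUpTo rw (z ∸ 1)) (sum-replicate r c) ⟩
    majUpTo rw (n ∸ 1)                   ≡⟨ majUpTo≡∑descents rw (n ∸ 1) ⟩
    ∑ descentsAfter (n ∸ 1)              ≡⟨ sym (+-identityʳ _) ⟩
    ∑ descentsAfter (n ∸ 1) + 0
      ≡⟨ cong (λ z → ∑ descentsAfter (n ∸ 1) + descents rw n z) (sym (n∸n≡0 n)) ⟩
    ∑ descentsAfter n                    ∎
    where open ≡-Reasoning

  dep≡∑bound : dep (replicate r c) ≡ ∑ bound n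
  dep≡∑bound = sym (∑descentBound≡dep c r)

  dep≤maj : dep (replicate r c) ≤ maj T
  dep≤maj = subst₂ _≤_ (sym dep≡∑bound) (sym maj≡∑descentsAfter)
    (∑-mono-≤ bound descentsAfter n bound-≤-descentsAfter)

  maj≤dep : descentsAfter 1 ≤ r₁ → maj T ≤ dep (replicate r c)
  maj≤dep D₁≤r₁ = subst₂ _≤_ (sym maj≡∑descentsAfter) (sym dep≡∑bound)
    (∑-mono-≤ descentsAfter bound n (descentsAfter-≤-bound D₁≤r₁))

  Tight : Set
  Tight = ∀ m → 2 ≤ m → m ≤ n → descentsAfter m ≤ bound m

  -- The excess of one over dep is spent at m = 1, so the bounds for m ≥ 2 are attained.
  descentsAfter-tight : maj T ≡ suc (dep (replicate r c)) → r₁ < descentsAfter 1 → Tight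
  descentsAfter-tight maj≡ r₁<D₁ (suc x) (s≤s 1≤x) (s≤s x≤n₀) =
    ∑-≤-pointwise (λ m → descentsAfter (suc m)) (λ m → bound (suc m)) n₀
      (λ m _ m≤n₀ → bound-≤-descentsAfter (suc m) z<s (s≤s m≤n₀)) X≤Y x 1≤x x≤n₀
    where
      n₀ X Y : ℕ
      n₀ = c₁ + r₁ * c   -- n = suc n₀ definitionally
      X = ∑ (λ m → descentsAfter (suc m)) n₀
      Y = ∑ (λ m → bound (suc m)) n₀
      D₁+X≡1+r₁+Y : descentsAfter 1 + X ≡ suc r₁ + Y
      D₁+X≡1+r₁+Y = begin
        descentsAfter 1 + X       ≡⟨ sym (∑-suc descentsAfter n₀) ⟩
        ∑ descentsAfter n         ≡⟨ sym maj≡∑descentsAfter ⟩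
        maj T                     ≡⟨ maj≡ ⟩
        suc (dep (replicate r c)) ≡⟨ cong suc dep≡∑bound ⟩
        suc (∑ bound n)           ≡⟨ cong suc (∑-suc bound n₀) ⟩
        suc r₁ + Y                ∎
        where open ≡-Reasoning
      X≤Y : X ≤ Y
      X≤Y = +-cancelˡ-≤ (suc r₁) X Y (≤-trans (+-monoˡ-≤ X r₁<D₁) (≤-reflexive D₁+X≡1+r₁+Y))

  2≤n : 1 ≤ c₁ → 2 ≤ n
  2≤n 1≤c₁ = ≤-trans (s≤s 1≤c₁) (m≤m+n c (r₁ * c))

  tight⇒rise-at-1 : 1 ≤ c₁ → r₁ < descentsAfter 1 → Tight → rw 1 < rw 2
  tight⇒rise-at-1 1≤c₁ r₁<D₁ tight = descentAt-rise rw 1 (+-cancelʳ-< (descentsAfter 2) 0 _ (begin-strict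
    descentsAfter 2                       ≤⟨ tight 2 ≤-refl (2≤n 1≤c₁) ⟩
    r₁ ∸ 1 / c                            ≡⟨ cong (r₁ ∸_) (m<n⇒m/n≡0 (s≤s 1≤c₁)) ⟩
    r₁                                    <⟨ r₁<D₁ ⟩
    descentsAfter 1                       ≡⟨ descentsBefore+descentsAfter 2 z<s (2≤n 1≤c₁) ⟩
    descentAt rw 1 + 0 + descentsAfter 2  ≡⟨ cong (_+ descentsAfter 2) (+-identityʳ _) ⟩
    descentAt rw 1 + descentsAfter 2      ∎))
    where open ≤-Reasoning

  tight⇒row≥1 : 1 ≤ r₁ → Tight → ∀ v → c < v → v ≤ n → 1 ≤ rw v
  tight⇒row≥1 1≤r₁ tight v@(suc q) c<v v≤n = n≢0⇒n>0 λ rw≡0 →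
    <-irrefl refl (subst (λ z → r₁ ∸ z < r₁) rw≡0 (begin-strict
      r₁ ∸ rw v           ≤⟨ rowsBelow-≤-descentsAfter v z<s v≤n ⟩
      descentsAfter v     ≤⟨ tight v (≤-trans (s≤s (s≤s z≤n)) c<v) v≤n ⟩
      r₁ ∸ q / c          ≤⟨ ∸-monoʳ-≤ r₁ (m≥n⇒m/n>0 (s≤s⁻¹ c<v)) ⟩
      r₁ ∸ 1              <⟨ ∸-monoʳ-< z<s 1≤r₁ ⟩
      r₁                  ∎))
    where open ≤-Reasoning

  -- The entries 2, c+1, …, n avoid row 0, which leaves only n-c cells for them.
  tight⇒⊥ : 1 ≤ c₁ → 1 ≤ r₁ → r₁ < descentsAfter 1 → Tight → ⊥
  tight⇒⊥ 1≤c₁ 1≤r₁ r₁<D₁ tight =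
    <-irrefl refl (band-capacity (suc (r₁ * c)) f 1 r₁ f≥1 f≤n row≥1 row<r′ f-inj)
    where
      f : Fin (suc (r₁ * c)) → ℕ
      f fzero    = 2
      f (fsuc x) = suc c + toℕ x
      f≥1 : ∀ x → 1 ≤ f x
      f≥1 fzero    = s≤s z≤n
      f≥1 (fsuc x) = s≤s z≤n
      f≤n : ∀ x → f x ≤ n
      f≤n fzero    = 2≤n 1≤c₁
      f≤n (fsuc x) = +-monoʳ-< c (toℕ<n x)
      row≥1 : ∀ x → 1 ≤ rw (f x)
      row≥1 fzero    = ≤-trans z<s (tight⇒rise-at-1 1≤c₁ r₁<D₁ tight)
      row≥1 (fsuc x) = tight⇒row≥1 1≤r₁ tight (f (fsuc x)) (s≤s (m≤m+n c _)) (f≤n (fsuc x))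
      row<r′ : ∀ x → rw (f x) < 1 + r₁
      row<r′ x = row<r (f x) (f≥1 x) (f≤n x)
      2<f-suc : ∀ x → 2 < f (fsuc x)
      2<f-suc x = ≤-trans (s≤s (s≤s 1≤c₁)) (m≤m+n (suc c) (toℕ x))
      f-inj : ∀ x y → f x ≡ f y → x ≡ y
      f-inj fzero    fzero    _ = refl
      f-inj fzero    (fsuc y) e = ⊥-elim (<⇒≢ (2<f-suc y) e)
      f-inj (fsuc x) fzero    e = ⊥-elim (<⇒≢ (2<f-suc x) (sym e))
      f-inj (fsuc x) (fsuc y) e = cong fsuc (toℕ-injective (+-cancelˡ-≡ (suc c) _ _ e))

  maj≢1+dep : 1 ≤ c₁ → 1 ≤ r₁ → maj T ≢ suc (dep (replicate r c))
  maj≢1+dep 1≤c₁ 1≤r₁ maj≡ =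
    [ (λ D₁≤r₁ → <-irrefl maj≡ (s≤s (maj≤dep D₁≤r₁)))
    , (λ r₁<D₁ → tight⇒⊥ 1≤c₁ 1≤r₁ r₁<D₁ (descentsAfter-tight maj≡ r₁<D₁))
    ]′ (≤-<-connex (descentsAfter 1) r₁)

mainTheorem9 : ∀ (c r k : ℕ) → 2 ≤ c → 2 ≤ r → k ≤ (c * r) C 2 →
    (k < dep (replicate r c) ⊎ k ≡ suc (dep (replicate r c))) →
    FakeDegreeCoeffZero (replicate r c) k
mainTheorem9 (suc c₁) (suc r₁) k (s≤s 1≤c₁) (s≤s 1≤r₁) _ k<dep⊎k≡1+dep T maj≡k =
  [ (λ k<dep → <⇒≱ k<dep (subst (dep (replicate (suc r₁) (suc c₁)) ≤_) maj≡k dep≤maj))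
  , (λ k≡1+dep → maj≢1+dep 1≤c₁ 1≤r₁ (trans maj≡k k≡1+dep)) ]′ k<dep⊎k≡1+dep
  where open RectangularTableau c₁ r₁ T
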